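{- Let $L$ be a finite geometric lattice of rank $r$. For $0\le k\le r-1$, the Jacobi coefficient $\beta_k=\langle\rho_k,H\rho_{k+1}\rangle$ of the radial compression of the lattice Hamiltonian is \[ \beta_k=\frac{1}{2\sqrt{n_kn_{k+1}}}\sum_{\substack{\operatorname{rk}(x)=k,\ x\lessdot y}}\bigl(a(y)-a(x)\bigr), \] where the sum runs over all cover pairs $x\lessdot y$ in $L$ with $\operatorname{rk}(x)=k$.
   Context: $\mathbb{R}[L]$ is the real vector space with orthonormal basis $\{e_x:x\in L\}$, basis vectors identified with lattice elements. The diamond product is given on basis elements by $x\diamond y=x\vee y$ if $x\wedge y=0$ (the bottom of $L$) and $x\diamond y=0$ otherwise. For an atom $a$, $L_a(x)=a\diamond x$, $L_a^t$ is its transpose, and the lattice Hamiltonian is $H=\sum_{a\in\mathcal{A}(L)}(L_a+L_a^t)/2$, with $\mathcal{A}(L)$ the set of atoms. $\operatorname{rk}$ is the rank function, $L_k=\{x:\operatorname{rk}(x)=k\}$, $n_k=|L_k|$, $\rho_k=n_k^{ -1/2}\sum_{x\in L_k}e_x$. The radial compression $J=P_{\mathrm{rad}}HP_{\mathrm{rad}}$ (with $P_{\mathrm{rad}}$ the orthogonal projection onto $\operatorname{span}\{\rho_0,\dots,\rho_r\}$) satisfies $J\rho_k=\beta_{k-1}\rho_{k-1}+\beta_k\rho_{k+1}$. For $x\in L$, $a(x)$ is the number of atoms below $x$. -}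

module Defs where

open import Level using (Level; 0ℓ; _⊔_) renaming (suc to lsuc)
open import Data.Nat as ℕ using (ℕ; zero; suc)
open import Data.Fin using (Fin)
open import Data.List using (allFin)
open import Data.Fin.Properties using (all?) renaming (_≟_ to _≟ᶠ_)
open import Data.List using (List; []; _∷_; foldr)
open import Data.List.Membership.Propositional using (_∈_)
open import Data.Product using (Σ; _×_; _,_)
open import Data.Sum using (_⊎_)
open import Relation.Nullary using (¬_; Dec; yes; no; _×-dec_; _⊎-dec_; _→-dec_; ¬?)
open import Relation.Binary using (Rel; Decidable; IsPartialOrder)
open import Relation.Binary.PropositionalEquality using (_≡_)
open import Relation.Binary.Lattice.Structures using (IsLattice)
open import Algebra.Bundles using (CommutativeRing)

-- Gradedness and
-- semimodularity are expressed (as in Stanley, EC1 §3.3) through the rank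
-- function rk: rk ⊥ = 0, rk increases by one along every cover relation,
-- and rk (x ∨ y) + rk (x ∧ y) ≤ rk x + rk y.  (Such an rk is unique: it is
-- the length of any maximal chain from ⊥ to x.)

record FiniteGeometricLattice : Set₁ where
  infix 4 _≤_ _<_ _⋖_
  infixr 6 _∨_
  infixr 7 _∧_
  field
    N        : ℕ
    _≤_      : Rel (Fin N) 0ℓ
    _≤?_     : Decidable _≤_
    _∨_      : Fin N → Fin N → Fin N
    _∧_      : Fin N → Fin N → Fin N
    isLattice : IsLattice _≡_ _≤_ _∨_ _∧_
    ⊥        : Fin N
    ⊥-least  : ∀ x → ⊥ ≤ x

  _<_ : Rel (Fin N) 0ℓ
  x < y = x ≤ y × ¬ (x ≡ y)

  _⋖_ : Rel (Fin N) 0ℓ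
  x ⋖ y = x < y × (∀ z → x ≤ z → z ≤ y → (z ≡ x) ⊎ (z ≡ y))

  IsAtom : Fin N → Set
  IsAtom a = ⊥ ⋖ a

  ⋁ : List (Fin N) → Fin N
  ⋁ = foldr _∨_ ⊥

  field
    rk          : Fin N → ℕ
    rk-⊥        : rk ⊥ ≡ 0
    rk-cover    : ∀ x y → x ⋖ y → rk y ≡ suc (rk x)
    semimodular : ∀ x y → rk (x ∨ y) ℕ.+ rk (x ∧ y) ℕ.≤ rk x ℕ.+ rk y
    atomistic   : ∀ x → Σ (List (Fin N)) λ as →
                    (∀ a → a ∈ as → IsAtom a)
                    × x ≡ ⋁ as


module LatticeDec (L : FiniteGeometricLattice) where
  open FiniteGeometricLattice L

  _<?_ : Decidable _<_
  x <? y = (x ≤? y) ×-dec ¬? (x ≟ᶠ y)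

  _⋖?_ : Decidable _⋖_
  x ⋖? y = (x <? y) ×-dec
           all? (λ z → (x ≤? z) →-dec ((z ≤? y) →-dec ((z ≟ᶠ x) ⊎-dec (z ≟ᶠ y))))

  atom? : ∀ a → Dec (IsAtom a)
  atom? a = ⊥ ⋖? a

  ⊤ : Fin N
  ⊤ = ⋁ (allFin N)

  rank : ℕ
  rank = rk ⊤

Σℕ : (n : ℕ) → (Fin n → ℕ) → ℕ
Σℕ zero    f = 0
Σℕ (suc n) f = f Fin.zero ℕ.+ Σℕ n (λ i → f (Fin.suc i))
  where import Data.Fin as Fin

count : (n : ℕ) {P : Fin n → Set} → (∀ i → Dec (P i)) → ℕ
count n P? = Σℕ n (λ i → ind (P? i))
  where
  ind : ∀ {A : Set} → Dec A → ℕ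
  ind (yes _) = 1
  ind (no  _) = 0

module LatticeCounts (L : FiniteGeometricLattice) where
  open FiniteGeometricLattice L
  open LatticeDec L

  nₖ : ℕ → ℕ
  nₖ k = count N (λ x → rk x ℕ.≟ k)

  atomsBelow : Fin N → ℕ
  atomsBelow x = count N (λ a → atom? a ×-dec (a ≤? x))

-- The space ℝ[L], with real scalars replaced by an arbitrary commutative
-- ring R.

module Hamiltonian {c ℓ} (R : CommutativeRing c ℓ) (L : FiniteGeometricLattice) where
  open CommutativeRing R
  open FiniteGeometricLattice L
  open LatticeDec L
  open LatticeCounts L

  ΣR : (n : ℕ) → (Fin n → Carrier) → Carrier
  ΣR zero    f = 0#
  ΣR (suc n) f = f Fin.zero + ΣR n (λ i → f (Fin.suc i))
    where import Data.Fin as Fin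

  fromℕ : ℕ → Carrier
  fromℕ zero    = 0#
  fromℕ (suc n) = 1# + fromℕ n

  [_] : ∀ {A : Set} → Dec A → Carrier
  [ yes _ ] = 1#
  [ no  _ ] = 0#

  Vector : Set c
  Vector = Fin N → Carrier

  e : Fin N → Vector
  e x z = [ x ≟ᶠ z ]

  ⟨_,_⟩ : Vector → Vector → Carrier
  ⟨ u , v ⟩ = ΣR N (λ z → u z * v z)

  -- diamond product on basis elements, as a coefficient:
  -- (a ⋄ x) has coefficient 1 at z iff a ∧ x = ⊥ and a ∨ x = z, else 0
  -- (x ⋄ y = 0 is the zero vector when x ∧ y ≠ ⊥).
  ⋄coeff : Fin N → Fin N → Fin N → Carrier
  ⋄coeff a x z = [ (a ∧ x) ≟ᶠ ⊥ ] * [ (a ∨ x) ≟ᶠ z ]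

  Lₐ : Fin N → Vector → Vector
  Lₐ a v z = ΣR N (λ x → ⋄coeff a x z * v x)

  Lₐᵗ : Fin N → Vector → Vector
  Lₐᵗ a v x = ΣR N (λ z → ⋄coeff a x z * v z)

  -- lattice Hamiltonian H = Σ_{a atom} (L_a + L_aᵗ)/2, where ½ is an
  -- element `half` of R with half + half = 1
  H : (half : Carrier) → Vector → Vector
  H half v z = half * ΣR N (λ a → [ atom? a ] * (Lₐ a v z + Lₐᵗ a v z))

  -- ρ_k = n_k^{-1/2} Σ_{rk x = k} e_x, where n_k^{-1/2} is supplied as an
  -- element s of R with s * s * n_k = 1
  ρ : (s : Carrier) → ℕ → Vector
  ρ s k z = s * [ rk z ℕ.≟ k ]

  β : (half sₖ sₖ₊₁ : Carrier) → ℕ → Carrier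
  β half sₖ sₖ₊₁ k = ⟨ ρ sₖ k , H half (ρ sₖ₊₁ (suc k)) ⟩

  coverSum : ℕ → Carrier
  coverSum k = ΣR N (λ x → ΣR N (λ y →
                 [ rk x ℕ.≟ k ] * [ x ⋖? y ] *
                 (fromℕ (atomsBelow y) - fromℕ (atomsBelow x))))

{-# OPTIONS --safe #-}
module Submission where

-- For z of rank k, (Lₐ ρ_{k+1})(z) = 0 because a ⋄ x lies above x, while (Lₐᵗ v)(z) is v(a ∨ z)
-- when the atom a is not below z and 0 otherwise; semimodularity makes a ∨ z cover z, so it has
-- rank k + 1.  Hence (H ρ_{k+1})(z) = ½ n_{k+1}^{-1/2} · #{atoms a ≰ z}.  On the other side
-- a(y) − a(z) counts the atoms below y but not below z, and every atom a ≰ z lies below exactly one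
-- cover of z, namely a ∨ z; so Σ_{z ⋖ y} (a(y) − a(z)) is again #{atoms a ≰ z}.

open import Defs
open import Algebra.Bundles using (CommutativeRing)
open import Data.Fin as Fin using (Fin)
open import Data.Fin.Induction using (po-wellFounded; po-noetherian)
open import Data.Fin.Properties using (¬∀⟶∃¬; punchInᵢ≢i) renaming (_≟_ to _≟ᶠ_)
open import Data.Nat as ℕ using (ℕ; zero; suc)
import Data.Nat.Properties as ℕ
open import Data.Product using (_×_; _,_; proj₁; ∃-syntax)
open import Data.Sum using (_⊎_; inj₁; inj₂)
open import Data.Vec.Functional using (removeAt)
open import Function using (_∘_; flip; _⇔_; mk⇔; Equivalence)
open import Induction.WellFounded using (Acc; acc)
open import Relation.Binary.Lattice.Structures using (IsLattice)
open import Relation.Binary.PropositionalEquality as ≡ using (_≡_)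
open import Relation.Nullary using (¬_; Dec; yes; no; contradiction; ¬?; _×-dec_; _→-dec_; _⊎-dec_)
open import Relation.Nullary.Decidable using (decidable-stable)
import Relation.Binary.Reasoning.Setoid as ≈-Reasoning

module GeometricLatticeProperties (L : FiniteGeometricLattice) where
  open FiniteGeometricLattice L
  open LatticeDec L
  open ≡ using (refl; sym; trans; cong; subst)
  open IsLattice isLattice
    using (isPartialOrder; antisym; x≤x∨y; y≤x∨y; ∨-least; x∧y≤x; x∧y≤y; ∧-greatest)
    renaming (refl to ≤-refl; trans to ≤-trans)

  ¬⋖⇒∃-between : ∀ {x y} → x < y → ¬ x ⋖ y → ∃[ z ] x < z × z < y
  ¬⋖⇒∃-between {x} {y} x<y ¬x⋖y
    with z , z∉]x,y[ ← ¬∀⟶∃¬ N _ (λ z → (x ≤? z) →-dec ((z ≤? y) →-dec ((z ≟ᶠ x) ⊎-dec (z ≟ᶠ y))))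
                                  (λ z∉]x,y[ → ¬x⋖y (x<y , z∉]x,y[))
    = z , (x≤z , z≢x ∘ sym) , (z≤y , z≢y)
    where
    x≤z : x ≤ z
    x≤z = decidable-stable (x ≤? z) λ x≰z → z∉]x,y[ (λ x≤z → contradiction x≤z x≰z)
    z≤y : z ≤ y
    z≤y = decidable-stable (z ≤? y) λ z≰y → z∉]x,y[ (λ _ z≤y → contradiction z≤y z≰y)
    z≢x : ¬ z ≡ x
    z≢x z≡x = z∉]x,y[ (λ _ _ → inj₁ z≡x)
    z≢y : ¬ z ≡ y
    z≢y z≡y = z∉]x,y[ (λ _ _ → inj₂ z≡y)

  <⇒∃≤⋖ : ∀ {x y} → x < y → ∃[ z ] x ≤ z × z ⋖ y
  <⇒∃≤⋖ {x} {y} = go (po-noetherian isPartialOrder x)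
    where
    go : ∀ {x} → Acc (flip _<_) x → x < y → ∃[ z ] x ≤ z × z ⋖ y
    go {x} (acc rec) x<y with x ⋖? y
    ... | yes x⋖y = x , ≤-refl , x⋖y
    ... | no ¬x⋖y =
      let u , x<u , u<y = ¬⋖⇒∃-between x<y ¬x⋖y
          z , u≤z , z⋖y = go (rec x<u) u<y
      in z , ≤-trans (proj₁ x<u) u≤z , z⋖y

  rk-mono-< : ∀ {x y} → x < y → rk x ℕ.< rk y
  rk-mono-< {x} {y} = go (po-wellFounded isPartialOrder y)
    where
    go : ∀ {y} → Acc _<_ y → x < y → rk x ℕ.< rk y
    go {y} (acc rec) x<y with z , x≤z , z⋖y ← <⇒∃≤⋖ x<y | x ≟ᶠ z
    ... | yes refl = ℕ.≤-reflexive (sym (rk-cover x y z⋖y))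
    ... | no x≢z = ℕ.<-trans (go (rec (proj₁ z⋖y)) (x≤z , x≢z)) (ℕ.≤-reflexive (sym (rk-cover z y z⋖y)))

  rk-mono-≤ : ∀ {x y} → x ≤ y → rk x ℕ.≤ rk y
  rk-mono-≤ {x} {y} x≤y with x ≟ᶠ y
  ... | yes refl = ℕ.≤-refl
  ... | no x≢y = ℕ.<⇒≤ (rk-mono-< (x≤y , x≢y))

  rk-atom : ∀ {a} → IsAtom a → rk a ≡ 1
  rk-atom ⊥⋖a = trans (rk-cover ⊥ _ ⊥⋖a) (cong suc rk-⊥)

  atom∧≡⊥⇔≰ : ∀ {a z} → IsAtom a → a ∧ z ≡ ⊥ ⇔ (¬ a ≤ z)
  atom∧≡⊥⇔≰ {a} {z} ((_ , ⊥≢a) , ⊥⋖a) = mk⇔ to from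
    where
    to : a ∧ z ≡ ⊥ → ¬ a ≤ z
    to a∧z≡⊥ a≤z = ⊥≢a (antisym (⊥-least a) (subst (a ≤_) a∧z≡⊥ (∧-greatest ≤-refl a≤z)))
    from : ¬ a ≤ z → a ∧ z ≡ ⊥
    from a≰z with ⊥⋖a (a ∧ z) (⊥-least _) (x∧y≤x a z)
    ... | inj₁ a∧z≡⊥ = a∧z≡⊥
    ... | inj₂ a∧z≡a = contradiction (subst (_≤ z) a∧z≡a (x∧y≤y a z)) a≰z

  rk-atom∨≤ : ∀ {a z} → IsAtom a → ¬ a ≤ z → rk (a ∨ z) ℕ.≤ suc (rk z)
  rk-atom∨≤ {a} {z} ⊥⋖a a≰z = begin
    rk (a ∨ z)                ≡⟨ ℕ.+-identityʳ _ ⟨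
    rk (a ∨ z) ℕ.+ 0          ≡⟨ cong (rk (a ∨ z) ℕ.+_) (trans (cong rk a∧z≡⊥) rk-⊥) ⟨
    rk (a ∨ z) ℕ.+ rk (a ∧ z) ≤⟨ semimodular a z ⟩
    rk a ℕ.+ rk z             ≡⟨ cong (ℕ._+ rk z) (rk-atom ⊥⋖a) ⟩
    suc (rk z)                ∎
    where
    open ℕ.≤-Reasoning
    a∧z≡⊥ : a ∧ z ≡ ⊥
    a∧z≡⊥ = Equivalence.from (atom∧≡⊥⇔≰ ⊥⋖a) a≰z

  ⋖-atom∨ : ∀ {a z} → IsAtom a → ¬ a ≤ z → z ⋖ a ∨ z
  ⋖-atom∨ {a} {z} ⊥⋖a a≰z = (y≤x∨y a z , z≢a∨z) , nothing-between
    where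
    z≢a∨z : ¬ z ≡ a ∨ z
    z≢a∨z z≡a∨z = a≰z (subst (a ≤_) (sym z≡a∨z) (x≤x∨y a z))
    nothing-between : ∀ w → z ≤ w → w ≤ a ∨ z → w ≡ z ⊎ w ≡ a ∨ z
    nothing-between w z≤w w≤a∨z with w ≟ᶠ z | w ≟ᶠ a ∨ z
    ... | yes w≡z | _         = inj₁ w≡z
    ... | no _    | yes w≡a∨z = inj₂ w≡a∨z
    ... | no w≢z  | no w≢a∨z  = contradiction (rk-atom∨≤ ⊥⋖a a≰z) (ℕ.<⇒≱ (begin-strict
      suc (rk z) <⟨ ℕ.s≤s (rk-mono-< (z≤w , w≢z ∘ sym)) ⟩
      suc (rk w) ≤⟨ rk-mono-< (w≤a∨z , w≢a∨z) ⟩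
      rk (a ∨ z) ∎))
      where open ℕ.≤-Reasoning

  ⋖-≡-∨ : ∀ {a z y} → ¬ a ≤ z → z ⋖ y → a ≤ y → y ≡ a ∨ z
  ⋖-≡-∨ {a} {z} {y} a≰z ((z≤y , _) , z⋖y) a≤y with z⋖y (a ∨ z) (y≤x∨y a z) (∨-least a≤y z≤y)
  ... | inj₁ a∨z≡z = contradiction (subst (a ≤_) a∨z≡z (x≤x∨y a z)) a≰z
  ... | inj₂ a∨z≡y = sym a∨z≡y

-- ΣR, [_] and fromℕ are defined inside Defs' Hamiltonian R L, hence the lattice parameter.
module SumProperties {c ℓ} (R : CommutativeRing c ℓ) (L : FiniteGeometricLattice) where
  open CommutativeRing R
  open Hamiltonian R L using (ΣR; [_]; fromℕ)
  open import Algebra.Properties.Semiring.Sum semiring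
    using (sum; sum-cong-≋; ∑-distrib-+; ∑-comm; *-distribˡ-sum; sum-remove; sum-replicate-zero)

  ΣR≈sum : ∀ n {f : Fin n → Carrier} → ΣR n f ≈ sum f
  ΣR≈sum zero    = refl
  ΣR≈sum (suc n) = +-congˡ (ΣR≈sum n)

  ΣR-cong : ∀ n {f g : Fin n → Carrier} → (∀ i → f i ≈ g i) → ΣR n f ≈ ΣR n g
  ΣR-cong n f≈g = trans (ΣR≈sum n) (trans (sum-cong-≋ f≈g) (sym (ΣR≈sum n)))

  ΣR-zero : ∀ n → ΣR n (λ _ → 0#) ≈ 0#
  ΣR-zero n = trans (ΣR≈sum n) (sum-replicate-zero n)

  ΣR-distrib-+ : ∀ n (f g : Fin n → Carrier) → ΣR n (λ i → f i + g i) ≈ ΣR n f + ΣR n g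
  ΣR-distrib-+ n f g =
    trans (ΣR≈sum n) (trans (∑-distrib-+ f g) (sym (+-cong (ΣR≈sum n) (ΣR≈sum n))))

  ΣR-*ˡ : ∀ n x (f : Fin n → Carrier) → ΣR n (λ i → x * f i) ≈ x * ΣR n f
  ΣR-*ˡ n x f = trans (ΣR≈sum n) (sym (trans (*-congˡ (ΣR≈sum n)) (*-distribˡ-sum x f)))

  ΣR-comm : ∀ m n (f : Fin m → Fin n → Carrier) →
            ΣR m (λ i → ΣR n (f i)) ≈ ΣR n (λ j → ΣR m (λ i → f i j))
  ΣR-comm m n f = trans (ΣR²≈sum² m n f) (trans (∑-comm f) (sym (ΣR²≈sum² n m (flip f))))
    where
    ΣR²≈sum² : ∀ m n (f : Fin m → Fin n → Carrier) → ΣR m (λ i → ΣR n (f i)) ≈ sum (λ i → sum (f i))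
    ΣR²≈sum² m n f = trans (ΣR-cong m (λ i → ΣR≈sum n)) (ΣR≈sum m)

  ΣR-single : ∀ n (f : Fin n → Carrier) j → (∀ i → ¬ i ≡ j → f i ≈ 0#) → ΣR n f ≈ f j
  ΣR-single (suc n) f j f≈0 = begin
    ΣR (suc n) f               ≈⟨ ΣR≈sum (suc n) {f} ⟩
    sum f                      ≈⟨ sum-remove {i = j} f ⟩
    f j + sum (removeAt f j)   ≈⟨ +-congˡ (sum-cong-≋ (λ i → f≈0 _ (punchInᵢ≢i j i))) ⟩
    f j + sum {n} (λ _ → 0#)   ≈⟨ +-congˡ (sum-replicate-zero n) ⟩
    f j + 0#                   ≈⟨ +-identityʳ (f j) ⟩
    f j                        ∎
    where open ≈-Reasoning setoid

  []≈1 : ∀ {A : Set} (A? : Dec A) → A → [ A? ] ≈ 1#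
  []≈1 (yes _) _ = refl
  []≈1 (no ¬a) a = contradiction a ¬a

  []≈0 : ∀ {A : Set} (A? : Dec A) → ¬ A → [ A? ] ≈ 0#
  []≈0 (yes a) ¬a = contradiction a ¬a
  []≈0 (no _)  _  = refl

  []-cong-⇔ : ∀ {A B : Set} (A? : Dec A) (B? : Dec B) → A ⇔ B → [ A? ] ≈ [ B? ]
  []-cong-⇔ (yes a) B? A⇔B = sym ([]≈1 B? (Equivalence.to A⇔B a))
  []-cong-⇔ (no ¬a) B? A⇔B = sym ([]≈0 B? (¬a ∘ Equivalence.from A⇔B))

  []-×-dec : ∀ {A B : Set} (A? : Dec A) (B? : Dec B) → [ A? ×-dec B? ] ≈ [ A? ] * [ B? ]
  []-×-dec (yes _) (yes _) = sym (*-identityˡ 1#)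
  []-×-dec (yes _) (no _)  = sym (*-identityˡ 0#)
  []-×-dec (no _)  _       = sym (zeroˡ _)

  []*-cong : ∀ {A : Set} (A? : Dec A) {x y} → (A → x ≈ y) → [ A? ] * x ≈ [ A? ] * y
  []*-cong (yes a) x≈y = *-congˡ (x≈y a)
  []*-cong (no _)  _   = trans (zeroˡ _) (sym (zeroˡ _))

  []-split : ∀ {A B : Set} (A? : Dec A) (B? : Dec B) → (A → B) → [ B? ] ≈ [ A? ] + [ ¬? A? ] * [ B? ]
  []-split (yes a) B? A⇒B = trans ([]≈1 B? (A⇒B a)) (sym (trans (+-congˡ (zeroˡ _)) (+-identityʳ 1#)))
  []-split (no _)  B? _   = sym (trans (+-identityˡ _) (*-identityˡ _))

  fromℕ-count : ∀ n {P : Fin n → Set} (P? : ∀ i → Dec (P i)) → fromℕ (count n P?) ≈ ΣR n (λ i → [ P? i ])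
  fromℕ-count zero    P? = refl
  fromℕ-count (suc n) P? with P? Fin.zero
  ... | yes _ = +-congˡ (fromℕ-count n (P? ∘ Fin.suc))
  ... | no _  = trans (fromℕ-count n (P? ∘ Fin.suc)) (sym (+-identityˡ _))

module RadialProperties {c ℓ} (R : CommutativeRing c ℓ) (L : FiniteGeometricLattice) where
  open CommutativeRing R
  open FiniteGeometricLattice L
  open LatticeDec L
  open LatticeCounts L
  open Hamiltonian R L
  open IsLattice isLattice using (x≤x∨y; y≤x∨y) renaming (trans to ≤-trans)
  open GeometricLatticeProperties L
  open SumProperties R L
  open ≈-Reasoning setoid
  open import Algebra.Properties.AbelianGroup +-abelianGroup using (xyx⁻¹≈y)
  open import Algebra.Solver.Ring.NaturalCoefficients.Default commutativeSemiring
    using (solve; _:*_; _:=_)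

  Lₐ-vanishes : ∀ a v z → (∀ x → x ≤ z → v x ≈ 0#) → Lₐ a v z ≈ 0#
  Lₐ-vanishes a v z v≈0 = trans (ΣR-cong N term≈0) (ΣR-zero N)
    where
    term≈0 : ∀ x → ⋄coeff a x z * v x ≈ 0#
    term≈0 x = begin
      [ a ∧ x ≟ᶠ ⊥ ] * [ a ∨ x ≟ᶠ z ] * v x    ≈⟨ *-assoc _ _ _ ⟩
      [ a ∧ x ≟ᶠ ⊥ ] * ([ a ∨ x ≟ᶠ z ] * v x)  ≈⟨ *-congˡ ([]*-cong (a ∨ x ≟ᶠ z) λ a∨x≡z →
                                                    v≈0 x (≡.subst (x ≤_) a∨x≡z (y≤x∨y a x))) ⟩
      [ a ∧ x ≟ᶠ ⊥ ] * ([ a ∨ x ≟ᶠ z ] * 0#)   ≈⟨ *-congˡ (zeroʳ _) ⟩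
      [ a ∧ x ≟ᶠ ⊥ ] * 0#                      ≈⟨ zeroʳ _ ⟩
      0#                                       ∎

  Lₐᵗ-apply : ∀ a v x → Lₐᵗ a v x ≈ [ a ∧ x ≟ᶠ ⊥ ] * v (a ∨ x)
  Lₐᵗ-apply a v x = trans (ΣR-single N _ (a ∨ x) off-diagonal) on-diagonal
    where
    off-diagonal : ∀ z → ¬ z ≡ a ∨ x → ⋄coeff a x z * v z ≈ 0#
    off-diagonal z z≢a∨x =
      trans (*-congʳ (trans (*-congˡ ([]≈0 (a ∨ x ≟ᶠ z) (z≢a∨x ∘ ≡.sym))) (zeroʳ _))) (zeroˡ _)
    on-diagonal : ⋄coeff a x (a ∨ x) * v (a ∨ x) ≈ [ a ∧ x ≟ᶠ ⊥ ] * v (a ∨ x)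
    on-diagonal = *-congʳ (trans (*-congˡ ([]≈1 (a ∨ x ≟ᶠ a ∨ x) ≡.refl)) (*-identityʳ _))

  atomsNotBelow : Fin N → Carrier
  atomsNotBelow z = ΣR N (λ a → [ atom? a ] * [ ¬? (a ≤? z) ])

  H-ρ-on-rank : ∀ half s k z → rk z ≡ k → H half (ρ s (suc k)) z ≈ half * (s * atomsNotBelow z)
  H-ρ-on-rank half s k z rk-z≡k = *-congˡ (trans (ΣR-cong N summand) (ΣR-*ˡ N s _))
    where
    v : Vector
    v = ρ s (suc k)
    v-vanishes-below : ∀ x → x ≤ z → v x ≈ 0#
    v-vanishes-below x x≤z = trans (*-congˡ ([]≈0 (rk x ℕ.≟ suc k) λ rk-x≡1+k →
      ℕ.1+n≰n (≡.subst₂ ℕ._≤_ rk-x≡1+k rk-z≡k (rk-mono-≤ x≤z)))) (zeroʳ s)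
    Lₐᵗ-on-atom : ∀ a → IsAtom a → Lₐᵗ a v z ≈ [ ¬? (a ≤? z) ] * s
    Lₐᵗ-on-atom a ⊥⋖a = begin
      Lₐᵗ a v z                               ≈⟨ Lₐᵗ-apply a v z ⟩
      [ a ∧ z ≟ᶠ ⊥ ] * v (a ∨ z)              ≈⟨ *-congʳ ([]-cong-⇔ (a ∧ z ≟ᶠ ⊥) (¬? (a ≤? z)) (atom∧≡⊥⇔≰ ⊥⋖a)) ⟩
      [ ¬? (a ≤? z) ] * (s * [ rk (a ∨ z) ℕ.≟ suc k ])
        ≈⟨ []*-cong (¬? (a ≤? z)) (λ a≰z → *-congˡ ([]≈1 (rk (a ∨ z) ℕ.≟ suc k)
             (≡.trans (rk-cover z (a ∨ z) (⋖-atom∨ ⊥⋖a a≰z)) (≡.cong suc rk-z≡k)))) ⟩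
      [ ¬? (a ≤? z) ] * (s * 1#)              ≈⟨ *-congˡ (*-identityʳ s) ⟩
      [ ¬? (a ≤? z) ] * s                     ∎
    summand : ∀ a → [ atom? a ] * (Lₐ a v z + Lₐᵗ a v z) ≈ s * ([ atom? a ] * [ ¬? (a ≤? z) ])
    summand a = begin
      [ atom? a ] * (Lₐ a v z + Lₐᵗ a v z)
        ≈⟨ []*-cong (atom? a) (λ ⊥⋖a → trans (+-cong (Lₐ-vanishes a v z v-vanishes-below) (Lₐᵗ-on-atom a ⊥⋖a))
                                             (+-identityˡ _)) ⟩
      [ atom? a ] * ([ ¬? (a ≤? z) ] * s)
        ≈⟨ solve 3 (λ A B s → A :* (B :* s) := s :* (A :* B)) refl _ _ s ⟩
      s * ([ atom? a ] * [ ¬? (a ≤? z) ])     ∎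

  fromℕ-atomsBelow : ∀ y → fromℕ (atomsBelow y) ≈ ΣR N (λ a → [ atom? a ] * [ a ≤? y ])
  fromℕ-atomsBelow y = trans (fromℕ-count N _) (ΣR-cong N (λ a → []-×-dec (atom? a) (a ≤? y)))

  atomsBelow-increment : ∀ {z y} → z ≤ y →
    fromℕ (atomsBelow y) - fromℕ (atomsBelow z) ≈ ΣR N (λ a → [ atom? a ] * ([ ¬? (a ≤? z) ] * [ a ≤? y ]))
  atomsBelow-increment {z} {y} z≤y = trans (+-congʳ split) (xyx⁻¹≈y _ _)
    where
    new : Fin N → Carrier
    new a = [ atom? a ] * ([ ¬? (a ≤? z) ] * [ a ≤? y ])
    split : fromℕ (atomsBelow y) ≈ fromℕ (atomsBelow z) + ΣR N new
    split = begin
      fromℕ (atomsBelow y)                                       ≈⟨ fromℕ-atomsBelow y ⟩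
      ΣR N (λ a → [ atom? a ] * [ a ≤? y ])
        ≈⟨ ΣR-cong N (λ a → trans (*-congˡ ([]-split (a ≤? z) (a ≤? y) (λ a≤z → ≤-trans a≤z z≤y)))
                                  (distribˡ _ _ _)) ⟩
      ΣR N (λ a → [ atom? a ] * [ a ≤? z ] + new a)              ≈⟨ ΣR-distrib-+ N _ new ⟩
      ΣR N (λ a → [ atom? a ] * [ a ≤? z ]) + ΣR N new           ≈⟨ +-congʳ (fromℕ-atomsBelow z) ⟨
      fromℕ (atomsBelow z) + ΣR N new                            ∎

  ΣR-covers-above-atom : ∀ {a z} → IsAtom a → ¬ a ≤ z → ΣR N (λ y → [ z ⋖? y ] * [ a ≤? y ]) ≈ 1#
  ΣR-covers-above-atom {a} {z} ⊥⋖a a≰z = trans (ΣR-single N _ (a ∨ z) off-diagonal) on-diagonal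
    where
    off-diagonal : ∀ y → ¬ y ≡ a ∨ z → [ z ⋖? y ] * [ a ≤? y ] ≈ 0#
    off-diagonal y y≢a∨z = trans (sym ([]-×-dec (z ⋖? y) (a ≤? y)))
      ([]≈0 ((z ⋖? y) ×-dec (a ≤? y)) λ (z⋖y , a≤y) → y≢a∨z (⋖-≡-∨ a≰z z⋖y a≤y))
    on-diagonal : [ z ⋖? (a ∨ z) ] * [ a ≤? (a ∨ z) ] ≈ 1#
    on-diagonal = trans (*-cong ([]≈1 (z ⋖? (a ∨ z)) (⋖-atom∨ ⊥⋖a a≰z)) ([]≈1 (a ≤? (a ∨ z)) (x≤x∨y a z)))
                        (*-identityˡ 1#)

  ΣR-cover-increments : ∀ z →
    ΣR N (λ y → [ z ⋖? y ] * (fromℕ (atomsBelow y) - fromℕ (atomsBelow z))) ≈ atomsNotBelow z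
  ΣR-cover-increments z = begin
    ΣR N (λ y → [ z ⋖? y ] * (fromℕ (atomsBelow y) - fromℕ (atomsBelow z)))
      ≈⟨ ΣR-cong N (λ y → []*-cong (z ⋖? y) (λ z⋖y → atomsBelow-increment (proj₁ (proj₁ z⋖y)))) ⟩
    ΣR N (λ y → [ z ⋖? y ] * ΣR N (λ a → A a * (B a * [ a ≤? y ])))
      ≈⟨ ΣR-cong N (λ y → sym (ΣR-*ˡ N _ _)) ⟩
    ΣR N (λ y → ΣR N (λ a → [ z ⋖? y ] * (A a * (B a * [ a ≤? y ]))))
      ≈⟨ ΣR-comm N N _ ⟩
    ΣR N (λ a → ΣR N (λ y → [ z ⋖? y ] * (A a * (B a * [ a ≤? y ]))))
      ≈⟨ ΣR-cong N (λ a → ΣR-cong N (λ y →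
           solve 4 (λ C A B D → C :* (A :* (B :* D)) := (A :* B) :* (C :* D)) refl _ (A a) (B a) _)) ⟩
    ΣR N (λ a → ΣR N (λ y → A a * B a * ([ z ⋖? y ] * [ a ≤? y ])))
      ≈⟨ ΣR-cong N (λ a → ΣR-*ˡ N _ _) ⟩
    ΣR N (λ a → A a * B a * ΣR N (λ y → [ z ⋖? y ] * [ a ≤? y ]))
      ≈⟨ ΣR-cong N exactly-one-cover ⟩
    atomsNotBelow z ∎
    where
    A B : Fin N → Carrier
    A a = [ atom? a ]
    B a = [ ¬? (a ≤? z) ]
    exactly-one-cover : ∀ a → A a * B a * ΣR N (λ y → [ z ⋖? y ] * [ a ≤? y ]) ≈ A a * B a
    exactly-one-cover a = begin
      A a * B a * ΣR N (λ y → [ z ⋖? y ] * [ a ≤? y ])    ≈⟨ *-assoc _ _ _ ⟩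
      A a * (B a * ΣR N (λ y → [ z ⋖? y ] * [ a ≤? y ]))  ≈⟨ []*-cong (atom? a) (λ ⊥⋖a → []*-cong (¬? (a ≤? z))
                                                               (ΣR-covers-above-atom ⊥⋖a)) ⟩
      A a * (B a * 1#)                                    ≈⟨ *-congˡ (*-identityʳ _) ⟩
      A a * B a                                           ∎

  atomsNotBelowOnRank : ℕ → Carrier
  atomsNotBelowOnRank k = ΣR N (λ z → [ rk z ℕ.≟ k ] * atomsNotBelow z)

  β≈atomsNotBelowOnRank : ∀ half sₖ sₖ₊₁ k →
    β half sₖ sₖ₊₁ k ≈ half * (sₖ * sₖ₊₁) * atomsNotBelowOnRank k
  β≈atomsNotBelowOnRank half sₖ sₖ₊₁ k = begin
    ΣR N (λ z → sₖ * [ rk z ℕ.≟ k ] * H half (ρ sₖ₊₁ (suc k)) z)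
      ≈⟨ ΣR-cong N (λ z → *-assoc _ _ _) ⟩
    ΣR N (λ z → sₖ * ([ rk z ℕ.≟ k ] * H half (ρ sₖ₊₁ (suc k)) z))
      ≈⟨ ΣR-cong N (λ z → *-congˡ ([]*-cong (rk z ℕ.≟ k) (H-ρ-on-rank half sₖ₊₁ k z))) ⟩
    ΣR N (λ z → sₖ * ([ rk z ℕ.≟ k ] * (half * (sₖ₊₁ * atomsNotBelow z))))
      ≈⟨ ΣR-cong N (λ z → solve 5 (λ s r h t T → s :* (r :* (h :* (t :* T))) := h :* (s :* t) :* (r :* T))
                                  refl sₖ _ half sₖ₊₁ _) ⟩
    ΣR N (λ z → half * (sₖ * sₖ₊₁) * ([ rk z ℕ.≟ k ] * atomsNotBelow z))
      ≈⟨ ΣR-*ˡ N _ _ ⟩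
    half * (sₖ * sₖ₊₁) * atomsNotBelowOnRank k ∎

  coverSum≈atomsNotBelowOnRank : ∀ k → coverSum k ≈ atomsNotBelowOnRank k
  coverSum≈atomsNotBelowOnRank k = ΣR-cong N λ z → begin
    ΣR N (λ y → [ rk z ℕ.≟ k ] * [ z ⋖? y ] * increment z y)    ≈⟨ ΣR-cong N (λ y → *-assoc _ _ _) ⟩
    ΣR N (λ y → [ rk z ℕ.≟ k ] * ([ z ⋖? y ] * increment z y))  ≈⟨ ΣR-*ˡ N _ _ ⟩
    [ rk z ℕ.≟ k ] * ΣR N (λ y → [ z ⋖? y ] * increment z y)    ≈⟨ *-congˡ (ΣR-cover-increments z) ⟩
    [ rk z ℕ.≟ k ] * atomsNotBelow z                           ∎
    where
    increment : Fin N → Fin N → Carrier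
    increment z y = fromℕ (atomsBelow y) - fromℕ (atomsBelow z)

theorem4p5 : ∀ {c ℓ} (R : CommutativeRing c ℓ) (L : FiniteGeometricLattice) →
    let open CommutativeRing R
        open FiniteGeometricLattice L
        open LatticeDec L
        open LatticeCounts L
        open Hamiltonian R L
    in (half sₖ sₖ₊₁ : Carrier) (k : ℕ) →
       k ℕ.< rank →
       half + half ≈ 1# →
       sₖ * sₖ * fromℕ (nₖ k) ≈ 1# →
       sₖ₊₁ * sₖ₊₁ * fromℕ (nₖ (suc k)) ≈ 1# →
       β half sₖ sₖ₊₁ k ≈ half * (sₖ * sₖ₊₁) * coverSum k
theorem4p5 R L half sₖ sₖ₊₁ k _ _ _ _ =
  trans (β≈atomsNotBelowOnRank half sₖ sₖ₊₁ k) (*-congˡ (sym (coverSum≈atomsNotBelowOnRank k)))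
  where
  open CommutativeRing R
  open RadialProperties R L
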